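{- Let $\Sigma$ be a nonempty finite set and $\mu$ a sub-additive measure over $\Sigma$. Then there exists $\Lambda\subseteq\Sigma$ such that $\Lambda$ is $\frac{1}{4\log|\Sigma|}$-fortified with respect to $\mu$, and $\mu(\Lambda)\geq \frac14\mu(\Sigma)$.
   Context: A sub-additive measure over a nonempty finite set $\Sigma$ is a function $\mu:2^\Sigma\to\mathbb{N}$ with $\mu(\emptyset)=0$, $\mu(\Lambda)\geq 1$ for every nonempty $\Lambda\subseteq\Sigma$, and $\mu(\Lambda\cup\Lambda')\leq\mu(\Lambda)+\mu(\Lambda')$ for all $\Lambda,\Lambda'\subseteq\Sigma$. A subset $\Lambda\subseteq\Sigma$ is $\rho$-fortified with respect to $\mu$ if for every $\tilde\Lambda\subseteq\Lambda$ it holds that $\mu(\tilde\Lambda)\geq\rho\cdot\frac{|\tilde\Lambda|}{|\Lambda|}\cdot\mu(\Lambda)$. Logarithms are base 2. -}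

module Defs where

open import Data.Nat using (ℕ; _+_; _*_; _^_; _≤_)
open import Data.Fin.Subset using (Subset; ⊥; _∪_; _⊆_; ∣_∣; Nonempty)
open import Relation.Binary.PropositionalEquality using (_≡_)

-- The finite ground set Σ is modelled as Fin n; subsets of Σ are Subset n.

record SubAdditive {n : ℕ} (μ : Subset n → ℕ) : Set where
  field
    empty-zero : μ ⊥ ≡ 0
    nonempty-pos : ∀ (Λ : Subset n) → Nonempty Λ → 1 ≤ μ Λ
    subadditive : ∀ (Λ Λ′ : Subset n) → μ (Λ ∪ Λ′) ≤ μ Λ + μ Λ′

-- Λ is ρ-fortified w.r.t. μ for ρ = 1 / (4 · log₂ n), where n = |Σ| ≥ 2.
-- The real inequality
--     μ(Λ̃) ≥ (1 / (4 log₂ n)) · (|Λ̃| / |Λ|) · μ(Λ)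
-- is, after multiplying by the positive quantity 4 · log₂ n · |Λ| and
-- exponentiating base 2 (monotone), equivalent to the ℕ-inequality
--     2 ^ (|Λ̃| · μ(Λ)) ≤ n ^ (4 · μ(Λ̃) · |Λ|).
-- (For Λ = ∅ the cleared form is trivially true, as usual.)
Fortified-1/4log : (n : ℕ) (μ : Subset n → ℕ) (Λ : Subset n) → Set
Fortified-1/4log n μ Λ =
  ∀ (Λ̃ : Subset n) → Λ̃ ⊆ Λ →
    2 ^ (∣ Λ̃ ∣ * μ Λ) ≤ n ^ (4 * μ Λ̃ * ∣ Λ ∣)

{-# OPTIONS --safe #-}
module Submission where

-- Start from Λ = Σ and, as long as some Λ̃ ⊆ Λ shows that Λ is not fortified,
-- replace Λ by Λ ∖ Λ̃.  Put N = 4 k with 2 ^ k ≤ n < 2 ^ (1 + k).  A witness Λ̃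
-- satisfies N μ(Λ̃) |Λ| < |Λ̃| μ(Λ), so sub-additivity and Bernoulli's inequality
-- (1 - x / N) ^ N ≥ 1 - x show that (μ(Λ) / μ(Σ)) ^ N ≥ |Λ| / n is preserved.
-- When the process stops, (μ(Σ) / μ(Λ)) ^ N ≤ n / |Λ| ≤ 2 ^ N, so μ(Σ) ≤ 2 μ(Λ).

open import Defs
open import Data.Nat
  using (ℕ; zero; suc; _+_; _*_; _^_; _⊓_; _≤_; _<_; z≤n; s≤s; z<s; NonZero; >-nonZero; _<?_)
open import Data.Nat.Properties
open import Data.Nat.Induction using (<-wellFounded)
open import Data.Nat.Tactic.RingSolver using (solve-∀)
open import Data.Fin using (zero)
open import Data.Fin.Subset using (Subset; ⊤; _─_; _∪_; _⊆_; ∣_∣; Nonempty; inside; outside)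
open import Data.Fin.Subset.Properties
  using (drop-∷-⊆; ∈⊤; ∣⊤∣≡n; x∈p⇒∣p-x∣<∣p∣; nonempty?; Empty-unique; anySubset?; _⊆?_)
open import Data.Vec using (_∷_; []; here)
open import Data.Product using (Σ-syntax; ∃; ∃-syntax; _×_; _,_)
open import Data.Sum using (_⊎_; inj₁; inj₂)
open import Induction.WellFounded using (Acc; acc)
open import Relation.Nullary using (yes; no; contradiction)
open import Relation.Nullary.Decidable using (_×-dec_)
open import Relation.Binary.PropositionalEquality using (_≡_; refl; sym; trans; cong; subst)

p─q∪q≡p : ∀ {n} {p q : Subset n} → q ⊆ p → (p ─ q) ∪ q ≡ p
p─q∪q≡p {p = []}          {[]}          _   = refl
p─q∪q≡p {p = outside ∷ p} {outside ∷ q} q⊆p = cong (outside ∷_) (p─q∪q≡p (drop-∷-⊆ q⊆p))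
p─q∪q≡p {p = inside ∷ p}  {outside ∷ q} q⊆p = cong (inside ∷_) (p─q∪q≡p (drop-∷-⊆ q⊆p))
p─q∪q≡p {p = inside ∷ p}  {inside ∷ q}  q⊆p = cong (inside ∷_) (p─q∪q≡p (drop-∷-⊆ q⊆p))
p─q∪q≡p {p = outside ∷ p} {inside ∷ q}  q⊆p with q⊆p here
... | ()

∣p─q∣+∣q∣≡∣p∣ : ∀ {n} {p q : Subset n} → q ⊆ p → ∣ p ─ q ∣ + ∣ q ∣ ≡ ∣ p ∣
∣p─q∣+∣q∣≡∣p∣ {p = []}          {[]}          _   = refl
∣p─q∣+∣q∣≡∣p∣ {p = outside ∷ p} {outside ∷ q} q⊆p = ∣p─q∣+∣q∣≡∣p∣ (drop-∷-⊆ q⊆p)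
∣p─q∣+∣q∣≡∣p∣ {p = inside ∷ p}  {outside ∷ q} q⊆p = cong suc (∣p─q∣+∣q∣≡∣p∣ (drop-∷-⊆ q⊆p))
∣p─q∣+∣q∣≡∣p∣ {p = inside ∷ p}  {inside ∷ q}  q⊆p =
  trans (+-suc ∣ p ─ q ∣ ∣ q ∣) (cong suc (∣p─q∣+∣q∣≡∣p∣ (drop-∷-⊆ q⊆p)))
∣p─q∣+∣q∣≡∣p∣ {p = outside ∷ p} {inside ∷ q}  q⊆p with q⊆p here
... | ()

Nonempty⇒∣p∣>0 : ∀ {n} {p : Subset n} → Nonempty p → 0 < ∣ p ∣
Nonempty⇒∣p∣>0 (_ , x∈p) = m<n⇒0<n (x∈p⇒∣p-x∣<∣p∣ x∈p)

Nonempty-⊤ : ∀ {n} → 0 < n → Nonempty (⊤ {n})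
Nonempty-⊤ {suc _} _ = zero , ∈⊤

μ>0⇒Nonempty : ∀ {n} {μ : Subset n → ℕ} → SubAdditive μ → ∀ {Λ} → 0 < μ Λ → Nonempty Λ
μ>0⇒Nonempty {μ = μ} μ-subadditive {Λ} μΛ>0 with nonempty? Λ
... | yes Λ≢∅ = Λ≢∅
... | no  Λ≡∅ = contradiction (trans (cong μ (Empty-unique Λ≡∅)) empty-zero) (n>0⇒n≢0 μΛ>0)
  where open SubAdditive μ-subadditive

m*n>0⇒m>0 : ∀ {m n} → 0 < m * n → 0 < m
m*n>0⇒m>0 {suc _} _ = z<s

m^n>0⇒m>0 : ∀ {m} n .{{_ : NonZero n}} → 0 < m ^ n → 0 < m
m^n>0⇒m>0 {suc _} _       _ = z<s
m^n>0⇒m>0 {zero}  (suc _) ()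

^-distribʳ-* : ∀ m n o → (m * n) ^ o ≡ m ^ o * n ^ o
^-distribʳ-* m n zero    = refl
^-distribʳ-* m n (suc o) =
  trans (cong (m * n *_) (^-distribʳ-* m n o)) ([m*n]*[o*p]≡[m*o]*[n*p] m n (m ^ o) (n ^ o))

^-cancelʳ-≤ : ∀ {m o} n .{{_ : NonZero n}} → m ^ n ≤ o ^ n → m ≤ o
^-cancelʳ-≤ n mⁿ≤oⁿ = ≮⇒≥ (λ o<m → <⇒≱ (^-monoˡ-< n o<m) mⁿ≤oⁿ)

2^k≤n∧n^e<2^f⇒k*e<f : ∀ {n} k e f → 2 ^ k ≤ n → n ^ e < 2 ^ f → k * e < f
2^k≤n∧n^e<2^f⇒k*e<f {n} k e f 2^k≤n nᵉ<2ᶠ = ≰⇒> λ f≤k*e → <⇒≱ nᵉ<2ᶠ (begin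
  2 ^ f        ≤⟨ ^-monoʳ-≤ 2 f≤k*e ⟩
  2 ^ (k * e)  ≡⟨ ^-*-assoc 2 k e ⟨
  (2 ^ k) ^ e  ≤⟨ ^-monoˡ-≤ e 2^k≤n ⟩
  n ^ e        ∎)
  where open ≤-Reasoning

log₂-bracket : ∀ n → 0 < n → ∃[ k ] 2 ^ k ≤ n × n < 2 ^ suc k
log₂-bracket 1             _ = 0 , ≤-refl , s≤s (s≤s z≤n)
log₂-bracket (suc (suc n)) _ with log₂-bracket (suc n) z<s
... | k , 2^k≤1+n , 2+n≤2^[1+k] with m≤n⇒m<n∨m≡n 2+n≤2^[1+k]
...   | inj₁ 2+n<2^[1+k] = k , m≤n⇒m≤1+n 2^k≤1+n , 2+n<2^[1+k]
...   | inj₂ 2+n≡2^[1+k] =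
  suc k , ≤-reflexive (sym 2+n≡2^[1+k]) , ≤-<-trans 2+n≤2^[1+k] (^-monoʳ-< 2 ≤-refl (n<1+n (suc k)))

-- M ^ N − b ^ N ≤ N d M ^ (N − 1) for M − b ≤ d, multiplied by M to avoid N − 1.
bernoulli : ∀ N {b d M} → b ≤ M → M ≤ b + d → M ^ suc N ≤ M * b ^ N + N * d * M ^ N
bernoulli zero    _   _     = ≤-reflexive (sym (+-identityʳ _))
bernoulli (suc N) {b} {d} {M} b≤M M≤b+d = begin
  M * (M * P)                                 ≤⟨ *-monoˡ-≤ (M * P) M≤b+d ⟩
  (b + d) * (M * P)                           ≡⟨ *-distribʳ-+ (M * P) b d ⟩
  b * (M * P) + d * (M * P)                   ≤⟨ +-monoˡ-≤ _ (*-monoʳ-≤ b (bernoulli N b≤M M≤b+d)) ⟩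
  b * (M * B + N * d * P) + d * (M * P)       ≡⟨ expand b M B (N * d * P) (d * (M * P)) ⟩
  M * (b * B) + b * (N * d * P) + d * (M * P)
    ≤⟨ +-monoˡ-≤ (d * (M * P)) (+-monoʳ-≤ (M * (b * B)) (*-monoˡ-≤ (N * d * P) b≤M)) ⟩
  M * (b * B) + M * (N * d * P) + d * (M * P) ≡⟨ collect M b B N d P ⟩
  M * (b * B) + suc N * d * (M * P)           ∎
  where
  open ≤-Reasoning
  P B : ℕ
  P = M ^ N
  B = b ^ N
  expand : ∀ b M B X Y → b * (M * B + X) + Y ≡ M * (b * B) + b * X + Y
  expand = solve-∀
  collect : ∀ M b B N d P →
    M * (b * B) + M * (N * d * P) + d * (M * P) ≡ M * (b * B) + suc N * d * (M * P)
  collect = solve-∀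

size-ratio<measure-ratio^N : ∀ N {M a m s s′ t} → 0 < M → M ≤ a + m → s′ + t ≡ s →
  N * m * s < t * M → M ^ N * s′ < a ^ N * s
size-ratio<measure-ratio^N N {M} {a} {m} {s} {s′} {t} M>0 M≤a+m s′+t≡s sparse =
  <-≤-trans (*-cancelˡ-< M _ _ (+-cancelʳ-< (M * P * t) _ _ (begin-strict
    M * (P * s′) + M * P * t          ≡⟨ factor M P s′ t ⟩
    M * P * (s′ + t)                  ≡⟨ cong (M * P *_) s′+t≡s ⟩
    M * P * s                         ≤⟨ *-monoˡ-≤ s (bernoulli N (m⊓n≤n a M) M≤b+m) ⟩
    (M * B + N * m * P) * s           ≡⟨ distribute M B N m P s ⟩
    M * (B * s) + P * (N * m * s)     <⟨ +-monoʳ-< _ (*-monoʳ-< P sparse) ⟩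
    M * (B * s) + P * (t * M)         ≡⟨ cong (M * (B * s) +_) (regroup P t M) ⟩
    M * (B * s) + M * P * t           ∎)))
  (*-monoˡ-≤ s (^-monoˡ-≤ N (m⊓n≤m a M)))
  where
  open ≤-Reasoning
  instance
    M≢0 : NonZero M
    M≢0 = >-nonZero M>0
    P≢0 : NonZero (M ^ N)
    P≢0 = m^n≢0 M N
  -- Bernoulli needs b ≤ M, so it is applied to a ⊓ M rather than a.
  b P B : ℕ
  b = a ⊓ M
  P = M ^ N
  B = b ^ N
  M≤b+m : M ≤ b + m
  M≤b+m = subst (M ≤_) (sym (+-distribʳ-⊓ m a M)) (⊓-glb M≤a+m (m≤m+n M m))
  factor : ∀ M P s′ t → M * (P * s′) + M * P * t ≡ M * P * (s′ + t)
  factor = solve-∀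
  distribute : ∀ M B N m P s → (M * B + N * m * P) * s ≡ M * (B * s) + P * (N * m * s)
  distribute = solve-∀
  regroup : ∀ P t M → P * (t * M) ≡ M * P * t
  regroup = solve-∀

cross-mul-≤-trans : ∀ a b c d e f .{{_ : NonZero d}} → a * d ≤ c * b → c * f ≤ e * d → a * f ≤ e * b
cross-mul-≤-trans a b c d e f ad≤cb cf≤ed = *-cancelʳ-≤ (a * f) (e * b) d (begin
  a * f * d  ≡⟨ swap a f d ⟩
  a * d * f  ≤⟨ *-monoˡ-≤ f ad≤cb ⟩
  c * b * f  ≡⟨ swap c b f ⟩
  c * f * b  ≤⟨ *-monoˡ-≤ b cf≤ed ⟩
  e * d * b  ≡⟨ swap e d b ⟩
  e * b * d  ∎)
  where
  open ≤-Reasoning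
  swap : ∀ x y z → x * y * z ≡ x * z * y
  swap = solve-∀

module Peeling {n : ℕ} {μ : Subset n → ℕ} (μ-subadditive : SubAdditive μ)
               (k : ℕ) .{{_ : NonZero k}} (2^k≤n : 2 ^ k ≤ n) where

  open SubAdditive μ-subadditive

  N : ℕ
  N = 4 * k

  instance
    N≢0 : NonZero N
    N≢0 = m*n≢0 4 k

  Breaks : Subset n → Subset n → Set
  Breaks Λ Λ̃ = Λ̃ ⊆ Λ × n ^ (4 * μ Λ̃ * ∣ Λ ∣) < 2 ^ (∣ Λ̃ ∣ * μ Λ)

  Heavy : Subset n → Set
  Heavy Λ = Nonempty Λ × μ ⊤ ^ N * ∣ Λ ∣ ≤ μ Λ ^ N * n

  fortified-or-broken : ∀ Λ → Fortified-1/4log n μ Λ ⊎ ∃ (Breaks Λ)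
  fortified-or-broken Λ
    with anySubset? (λ Λ̃ → Λ̃ ⊆? Λ ×-dec n ^ (4 * μ Λ̃ * ∣ Λ ∣) <? 2 ^ (∣ Λ̃ ∣ * μ Λ))
  ... | yes broken = inj₂ broken
  ... | no ¬broken = inj₁ λ Λ̃ Λ̃⊆Λ → ≮⇒≥ λ violated → ¬broken (Λ̃ , Λ̃⊆Λ , violated)

  Breaks⇒sparse : ∀ {Λ Λ̃} → Breaks Λ Λ̃ → N * μ Λ̃ * ∣ Λ ∣ < ∣ Λ̃ ∣ * μ Λ
  Breaks⇒sparse {Λ} {Λ̃} (_ , violated) =
    subst (_< ∣ Λ̃ ∣ * μ Λ) (regroup k (μ Λ̃) ∣ Λ ∣)
      (2^k≤n∧n^e<2^f⇒k*e<f k (4 * μ Λ̃ * ∣ Λ ∣) (∣ Λ̃ ∣ * μ Λ) 2^k≤n violated)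
    where
    regroup : ∀ k m s → k * (4 * m * s) ≡ 4 * k * m * s
    regroup = solve-∀

  peel : ∀ {Λ Λ̃} → Heavy Λ → Breaks Λ Λ̃ → ∣ Λ ─ Λ̃ ∣ < ∣ Λ ∣ × Heavy (Λ ─ Λ̃)
  peel {Λ} {Λ̃} (Λ≢∅ , heavy) breaks@(Λ̃⊆Λ , _) =
    shrinks , μ>0⇒Nonempty μ-subadditive μ[Λ─Λ̃]>0 , heavy′
    where
    instance
      ∣Λ∣≢0 : NonZero ∣ Λ ∣
      ∣Λ∣≢0 = >-nonZero (Nonempty⇒∣p∣>0 Λ≢∅)
    sizes : ∣ Λ ─ Λ̃ ∣ + ∣ Λ̃ ∣ ≡ ∣ Λ ∣
    sizes = ∣p─q∣+∣q∣≡∣p∣ Λ̃⊆Λ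
    sparse : N * μ Λ̃ * ∣ Λ ∣ < ∣ Λ̃ ∣ * μ Λ
    sparse = Breaks⇒sparse breaks
    covered : μ Λ ≤ μ (Λ ─ Λ̃) + μ Λ̃
    covered = subst (λ Λ′ → μ Λ′ ≤ μ (Λ ─ Λ̃) + μ Λ̃) (p─q∪q≡p Λ̃⊆Λ) (subadditive (Λ ─ Λ̃) Λ̃)
    ratio : μ Λ ^ N * ∣ Λ ─ Λ̃ ∣ < μ (Λ ─ Λ̃) ^ N * ∣ Λ ∣
    ratio = size-ratio<measure-ratio^N N (nonempty-pos Λ Λ≢∅) covered sizes sparse
    μ[Λ─Λ̃]>0 : 0 < μ (Λ ─ Λ̃)
    μ[Λ─Λ̃]>0 = m^n>0⇒m>0 N (m*n>0⇒m>0 (m<n⇒0<n ratio))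
    heavy′ : μ ⊤ ^ N * ∣ Λ ─ Λ̃ ∣ ≤ μ (Λ ─ Λ̃) ^ N * n
    heavy′ = cross-mul-≤-trans (μ ⊤ ^ N) n (μ Λ ^ N) (∣ Λ ∣) (μ (Λ ─ Λ̃) ^ N) (∣ Λ ─ Λ̃ ∣)
               heavy (<⇒≤ ratio)
    shrinks : ∣ Λ ─ Λ̃ ∣ < ∣ Λ ∣
    shrinks = subst (∣ Λ ─ Λ̃ ∣ <_) sizes (m<m+n ∣ Λ ─ Λ̃ ∣ (m*n>0⇒m>0 (m<n⇒0<n sparse)))

  fortify : ∀ Λ → Acc _<_ ∣ Λ ∣ → Heavy Λ → Σ[ Λ′ ∈ Subset n ] (Fortified-1/4log n μ Λ′ × Heavy Λ′)
  fortify Λ (acc smaller) heavy with fortified-or-broken Λ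
  ... | inj₁ fortified       = Λ , fortified , heavy
  ... | inj₂ (Λ̃ , breaks) with peel heavy breaks
  ...   | shrinks , heavy′ = fortify (Λ ─ Λ̃) (smaller shrinks) heavy′

  Heavy-⊤ : Heavy ⊤
  Heavy-⊤ = Nonempty-⊤ {n} (≤-trans (m^n>0 2 k) 2^k≤n) , ≤-reflexive (cong (μ ⊤ ^ N *_) (∣⊤∣≡n n))

  Heavy⇒μ⊤≤2μ : ∀ {Λ} → n ≤ 2 ^ N → Heavy Λ → μ ⊤ ≤ 2 * μ Λ
  Heavy⇒μ⊤≤2μ {Λ} n≤2^N (Λ≢∅ , heavy) = ^-cancelʳ-≤ N (begin
    μ ⊤ ^ N              ≤⟨ m≤m*n (μ ⊤ ^ N) ∣ Λ ∣ ⟩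
    μ ⊤ ^ N * ∣ Λ ∣      ≤⟨ heavy ⟩
    μ Λ ^ N * n          ≤⟨ *-monoʳ-≤ (μ Λ ^ N) n≤2^N ⟩
    μ Λ ^ N * 2 ^ N      ≡⟨ *-comm (μ Λ ^ N) (2 ^ N) ⟩
    2 ^ N * μ Λ ^ N      ≡⟨ ^-distribʳ-* 2 (μ Λ) N ⟨
    (2 * μ Λ) ^ N        ∎)
    where
    open ≤-Reasoning
    instance
      ∣Λ∣≢0 : NonZero ∣ Λ ∣
      ∣Λ∣≢0 = >-nonZero (Nonempty⇒∣p∣>0 Λ≢∅)

lemma3p6 : (n : ℕ) → 2 ≤ n → (μ : Subset n → ℕ) → SubAdditive μ →
    Σ[ Λ ∈ Subset n ] (Fortified-1/4log n μ Λ × μ ⊤ ≤ 4 * μ Λ)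
lemma3p6 n 2≤n μ μ-subadditive with log₂-bracket n (≤-trans z<s 2≤n)
... | zero      , _     , n<2         = contradiction 2≤n (<⇒≱ n<2)
... | k@(suc _) , 2^k≤n , n<2^[1+k] =
  let Λ , fortified , heavy = fortify ⊤ (<-wellFounded ∣ ⊤ {n} ∣) Heavy-⊤
  in  Λ , fortified , ≤-trans (Heavy⇒μ⊤≤2μ n≤2^N heavy) (*-monoˡ-≤ (μ Λ) (m≤m+n 2 2))
  where
  open Peeling μ-subadditive k 2^k≤n
  n≤2^N : n ≤ 2 ^ N
  n≤2^N = ≤-trans (<⇒≤ n<2^[1+k]) (^-monoʳ-≤ 2 (+-mono-≤ {1} {k} z<s (m≤m+n k (2 * k))))
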